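{- For all $\lambda$-terms $t,t',s,s'$, variable $x$ and $n,m\in\mathbb N$: if $t\Rightarrow_\beta^nt'$ and $s\Rightarrow_\beta^ms'$, then $t\{x:=s\}\Rightarrow_\beta^kt'\{x:=s'\}$ where $k=n+|t'|_x\cdot m$.
   Context: $\lambda$-terms: $t::=x\mid\lambda x.t\mid ts$ (up to $\alpha$-equivalence); $t\{x:=s\}$ capture-avoiding substitution; $|t|_x$ number of free occurrences of $x$ in $t$. Indexed parallel $\beta$ reduction $\Rightarrow_\beta^n$ ($n\in\mathbb N$) is inductively defined by: $x\Rightarrow_\beta^0x$; if $t\Rightarrow_\beta^nt'$ then $\lambda x.t\Rightarrow_\beta^n\lambda x.t'$; if $t\Rightarrow_\beta^nt'$ and $s\Rightarrow_\beta^ms'$ then $ts\Rightarrow_\beta^{n+m}t's'$ and $(\lambda x.t)s\Rightarrow_\beta^{n+|t'|_x\cdot m+1}t'\{x:=s'\}$. -}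

module Defs where

open import Data.Nat using (ℕ; zero; suc; _+_; _*_)
open import Data.Fin using (Fin; zero; suc; punchOut)
open import Data.Fin.Properties using (_≟_)
open import Relation.Nullary using (yes; no)

-- λ-terms up to α-equivalence: well-scoped de Bruijn terms over n free variables.
data Term : ℕ → Set where
  var : ∀ {n} → Fin n → Term n
  lam : ∀ {n} → Term (suc n) → Term n
  app : ∀ {n} → Term n → Term n → Term n

ext : ∀ {n m} → (Fin n → Fin m) → Fin (suc n) → Fin (suc m)
ext ρ zero = zero
ext ρ (suc i) = suc (ρ i)

rename : ∀ {n m} → (Fin n → Fin m) → Term n → Term m
rename ρ (var i) = var (ρ i)
rename ρ (lam t) = lam (rename (ext ρ) t)
rename ρ (app t s) = app (rename ρ t) (rename ρ s)

exts : ∀ {n m} → (Fin n → Term m) → Fin (suc n) → Term (suc m)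
exts σ zero = var zero
exts σ (suc i) = rename suc (σ i)

subst : ∀ {n m} → (Fin n → Term m) → Term n → Term m
subst σ (var i) = σ i
subst σ (lam t) = lam (subst (exts σ) t)
subst σ (app t s) = app (subst σ t) (subst σ s)

-- the substitution replacing variable x by s (other variables are renumbered)
point : ∀ {n} → Fin (suc n) → Term n → Fin (suc n) → Term n
point x s y with x ≟ y
... | yes _ = s
... | no x≢y = var (punchOut x≢y)

_[_:=_] : ∀ {n} → Term (suc n) → Fin (suc n) → Term n → Term n
t [ x := s ] = subst (point x s) t

occ : ∀ {n} → Fin n → Term n → ℕ
occ x (var y) with x ≟ y
... | yes _ = 1
... | no _ = 0
occ x (lam t) = occ (suc x) t
occ x (app t s) = occ x t + occ x s

data _⇒β[_]_ : ∀ {k} → Term k → ℕ → Term k → Set where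
  ⇒var : ∀ {k} {x : Fin k} → var x ⇒β[ 0 ] var x
  ⇒lam : ∀ {k} {t t' : Term (suc k)} {n} → t ⇒β[ n ] t' → lam t ⇒β[ n ] lam t'
  ⇒app : ∀ {k} {t t' s s' : Term k} {n m} →
         t ⇒β[ n ] t' → s ⇒β[ m ] s' → app t s ⇒β[ n + m ] app t' s'
  ⇒beta : ∀ {k} {t t' : Term (suc k)} {s s' : Term k} {n m} →
          t ⇒β[ n ] t' → s ⇒β[ m ] s' →
          app (lam t) s ⇒β[ n + occ zero t' * m + 1 ] (t' [ zero := s' ])

module Submission where

-- The proof generalises the statement from a single substitution {x:=s} to
-- parallel substitutions: if σ i ⇒β[ w i ] σ' i for every variable i, and
-- t ⇒β[ k ] t', then subst σ t ⇒β[ k + weight w t' ] subst σ' t', where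
-- weight w t' = Σ over free occurrences i of t' of w i.  This is proved by
-- induction on the derivation of t ⇒β[ k ] t' (the binder case needs that
-- reduction is stable under renaming).  The theorem is the instance
-- σ = {x:=s}, σ' = {x:=s'}, w = m at x and 0 elsewhere, for which
-- weight w t' = |t'|_x · m.

open import Defs
open import Data.Nat using (ℕ; suc; _+_; _*_)
open import Data.Nat.Properties using (+-identityʳ; *-distribʳ-+)
open import Data.Nat.Solver using (module +-*-Solver)
open import Data.Fin using (Fin; zero; suc)
open import Data.Fin.Properties using (_≟_)
open import Relation.Nullary using (yes; no)
open import Relation.Binary.PropositionalEquality using (_≡_; refl; sym; trans; cong; cong₂; module ≡-Reasoning)
open ≡-Reasoning

rename-cong : ∀ {n m} {ρ ρ' : Fin n → Fin m} → (∀ i → ρ i ≡ ρ' i) →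
              ∀ t → rename ρ t ≡ rename ρ' t
rename-cong e (var i) = cong var (e i)
rename-cong {ρ = ρ} {ρ'} e (lam t) = cong lam (rename-cong e↑ t)
  where
    e↑ : ∀ i → ext ρ i ≡ ext ρ' i
    e↑ zero = refl
    e↑ (suc i) = cong suc (e i)
rename-cong e (app t s) = cong₂ app (rename-cong e t) (rename-cong e s)

subst-cong : ∀ {n m} {σ σ' : Fin n → Term m} → (∀ i → σ i ≡ σ' i) →
             ∀ t → subst σ t ≡ subst σ' t
subst-cong e (var i) = e i
subst-cong {σ = σ} {σ'} e (lam t) = cong lam (subst-cong e↑ t)
  where
    e↑ : ∀ i → exts σ i ≡ exts σ' i
    e↑ zero = refl
    e↑ (suc i) = cong (rename suc) (e i)
subst-cong e (app t s) = cong₂ app (subst-cong e t) (subst-cong e s)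

rename-rename : ∀ {n m p} (ρ : Fin m → Fin p) (ρ' : Fin n → Fin m) t →
                rename ρ (rename ρ' t) ≡ rename (λ i → ρ (ρ' i)) t
rename-rename ρ ρ' (var i) = refl
rename-rename ρ ρ' (lam t) =
  cong lam (trans (rename-rename (ext ρ) (ext ρ') t) (rename-cong e t))
  where
    e : ∀ i → ext ρ (ext ρ' i) ≡ ext (λ i → ρ (ρ' i)) i
    e zero = refl
    e (suc i) = refl
rename-rename ρ ρ' (app t s) = cong₂ app (rename-rename ρ ρ' t) (rename-rename ρ ρ' s)

rename-subst : ∀ {n m p} (ρ : Fin m → Fin p) (σ : Fin n → Term m) t →
               rename ρ (subst σ t) ≡ subst (λ i → rename ρ (σ i)) t
rename-subst ρ σ (var i) = refl
rename-subst ρ σ (lam t) =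
  cong lam (trans (rename-subst (ext ρ) (exts σ) t) (subst-cong e t))
  where
    e : ∀ i → rename (ext ρ) (exts σ i) ≡ exts (λ i → rename ρ (σ i)) i
    e zero = refl
    e (suc i) = trans (rename-rename (ext ρ) suc (σ i)) (sym (rename-rename suc ρ (σ i)))
rename-subst ρ σ (app t s) = cong₂ app (rename-subst ρ σ t) (rename-subst ρ σ s)

subst-rename : ∀ {n m p} (σ : Fin m → Term p) (ρ : Fin n → Fin m) t →
               subst σ (rename ρ t) ≡ subst (λ i → σ (ρ i)) t
subst-rename σ ρ (var i) = refl
subst-rename σ ρ (lam t) =
  cong lam (trans (subst-rename (exts σ) (ext ρ) t) (subst-cong e t))
  where
    e : ∀ i → exts σ (ext ρ i) ≡ exts (λ i → σ (ρ i)) i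
    e zero = refl
    e (suc i) = refl
subst-rename σ ρ (app t s) = cong₂ app (subst-rename σ ρ t) (subst-rename σ ρ s)

subst-subst : ∀ {n m p} (σ : Fin m → Term p) (τ : Fin n → Term m) t →
              subst σ (subst τ t) ≡ subst (λ i → subst σ (τ i)) t
subst-subst σ τ (var i) = refl
subst-subst σ τ (lam t) =
  cong lam (trans (subst-subst (exts σ) (exts τ) t) (subst-cong e t))
  where
    e : ∀ i → subst (exts σ) (exts τ i) ≡ exts (λ i → subst σ (τ i)) i
    e zero = refl
    e (suc i) = trans (subst-rename (exts σ) suc (τ i)) (sym (rename-subst suc σ (τ i)))
subst-subst σ τ (app t s) = cong₂ app (subst-subst σ τ t) (subst-subst σ τ s)

subst-id : ∀ {n} (t : Term n) → subst var t ≡ t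
subst-id (var i) = refl
subst-id (lam t) = cong lam (trans (subst-cong e t) (subst-id t))
  where
    e : ∀ i → exts var i ≡ var i
    e zero = refl
    e (suc i) = refl
subst-id (app t s) = cong₂ app (subst-id t) (subst-id s)

rename-[0:=] : ∀ {n m} (ρ : Fin n → Fin m) (t : Term (suc n)) (s : Term n) →
               (rename (ext ρ) t) [ zero := rename ρ s ] ≡ rename ρ (t [ zero := s ])
rename-[0:=] ρ t s = begin
  subst (point zero (rename ρ s)) (rename (ext ρ) t)  ≡⟨ subst-rename _ (ext ρ) t ⟩
  subst (λ i → point zero (rename ρ s) (ext ρ i)) t   ≡⟨ subst-cong e t ⟩
  subst (λ i → rename ρ (point zero s i)) t           ≡⟨ sym (rename-subst ρ _ t) ⟩
  rename ρ (subst (point zero s) t)                   ∎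
  where
    e : ∀ i → point zero (rename ρ s) (ext ρ i) ≡ rename ρ (point zero s i)
    e zero = refl
    e (suc i) = refl

subst-[0:=] : ∀ {n m} (σ : Fin n → Term m) (t : Term (suc n)) (s : Term n) →
              (subst (exts σ) t) [ zero := subst σ s ] ≡ subst σ (t [ zero := s ])
subst-[0:=] σ t s = begin
  subst (point zero (subst σ s)) (subst (exts σ) t)           ≡⟨ subst-subst _ (exts σ) t ⟩
  subst (λ i → subst (point zero (subst σ s)) (exts σ i)) t   ≡⟨ subst-cong e t ⟩
  subst (λ i → subst σ (point zero s i)) t                    ≡⟨ sym (subst-subst σ _ t) ⟩
  subst σ (subst (point zero s) t)                            ∎
  where
    e : ∀ i → subst (point zero (subst σ s)) (exts σ i) ≡ subst σ (point zero s i)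
    e zero = refl
    e (suc i) = trans (subst-rename _ suc (σ i)) (subst-id (σ i))

wext : ∀ {n} → (Fin n → ℕ) → Fin (suc n) → ℕ
wext w zero = 0
wext w (suc i) = w i

weight : ∀ {n} → (Fin n → ℕ) → Term n → ℕ
weight w (var i) = w i
weight w (lam t) = weight (wext w) t
weight w (app t s) = weight w t + weight w s

weight-cong : ∀ {n} {w v : Fin n → ℕ} → (∀ i → w i ≡ v i) → ∀ t → weight w t ≡ weight v t
weight-cong e (var i) = e i
weight-cong {w = w} {v} e (lam t) = weight-cong e↑ t
  where
    e↑ : ∀ i → wext w i ≡ wext v i
    e↑ zero = refl
    e↑ (suc i) = e i
weight-cong e (app t s) = cong₂ _+_ (weight-cong e t) (weight-cong e s)

weight-rename : ∀ {n m} (w : Fin m → ℕ) (ρ : Fin n → Fin m) t →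
                weight w (rename ρ t) ≡ weight (λ i → w (ρ i)) t
weight-rename w ρ (var i) = refl
weight-rename w ρ (lam t) = trans (weight-rename (wext w) (ext ρ) t) (weight-cong e t)
  where
    e : ∀ i → wext w (ext ρ i) ≡ wext (λ i → w (ρ i)) i
    e zero = refl
    e (suc i) = refl
weight-rename w ρ (app t s) = cong₂ _+_ (weight-rename w ρ t) (weight-rename w ρ s)

weight-subst : ∀ {n m} (w : Fin m → ℕ) (σ : Fin n → Term m) t →
               weight w (subst σ t) ≡ weight (λ i → weight w (σ i)) t
weight-subst w σ (var i) = refl
weight-subst w σ (lam t) = trans (weight-subst (wext w) (exts σ) t) (weight-cong e t)
  where
    e : ∀ i → weight (wext w) (exts σ i) ≡ wext (λ i → weight w (σ i)) i
    e zero = refl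
    e (suc i) = weight-rename (wext w) suc (σ i)
weight-subst w σ (app t s) = cong₂ _+_ (weight-subst w σ t) (weight-subst w σ s)

interchange : ∀ a b c d → (a + b) + (c + d) ≡ (a + c) + (b + d)
interchange = solve 4 (λ a b c d → (a :+ b) :+ (c :+ d) := (a :+ c) :+ (b :+ d)) refl
  where open +-*-Solver

weight-zero : ∀ {n} (t : Term n) → weight (λ _ → 0) t ≡ 0
weight-zero (var i) = refl
weight-zero (lam t) = trans (weight-cong e t) (weight-zero t)
  where
    e : ∀ i → wext (λ _ → 0) i ≡ 0
    e zero = refl
    e (suc i) = refl
weight-zero (app t s) = cong₂ _+_ (weight-zero t) (weight-zero s)

weight-+ : ∀ {n} (u v : Fin n → ℕ) t →
           weight (λ i → u i + v i) t ≡ weight u t + weight v t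
weight-+ u v (var i) = refl
weight-+ u v (lam t) = trans (weight-cong e t) (weight-+ (wext u) (wext v) t)
  where
    e : ∀ i → wext (λ i → u i + v i) i ≡ wext u i + wext v i
    e zero = refl
    e (suc i) = refl
weight-+ u v (app t s) = begin
  weight (λ i → u i + v i) t + weight (λ i → u i + v i) s
    ≡⟨ cong₂ _+_ (weight-+ u v t) (weight-+ u v s) ⟩
  (weight u t + weight v t) + (weight u s + weight v s)
    ≡⟨ interchange (weight u t) (weight v t) (weight u s) (weight v s) ⟩
  (weight u t + weight u s) + (weight v t + weight v s) ∎

weight-* : ∀ {n} (u : Fin n → ℕ) c t → weight (λ i → u i * c) t ≡ weight u t * c
weight-* u c (var i) = refl
weight-* u c (lam t) = trans (weight-cong e t) (weight-* (wext u) c t)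
  where
    e : ∀ i → wext (λ i → u i * c) i ≡ wext u i * c
    e zero = refl
    e (suc i) = refl
weight-* u c (app t s) = begin
  weight (λ i → u i * c) t + weight (λ i → u i * c) s  ≡⟨ cong₂ _+_ (weight-* u c t) (weight-* u c s) ⟩
  weight u t * c + weight u s * c                      ≡⟨ sym (*-distribʳ-+ c (weight u t) (weight u s)) ⟩
  (weight u t + weight u s) * c                        ∎

indicator : ∀ {n} → Fin n → Fin n → ℕ
indicator x y with x ≟ y
... | yes _ = 1
... | no _ = 0

occ≡weight : ∀ {n} (x : Fin n) t → occ x t ≡ weight (indicator x) t
occ≡weight x (var y) with x ≟ y
... | yes _ = refl
... | no _ = refl
occ≡weight x (lam t) = trans (occ≡weight (suc x) t) (weight-cong e t)
  where
    e : ∀ i → indicator (suc x) i ≡ wext (indicator x) i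
    e zero = refl
    e (suc i) with x ≟ i
    ... | yes _ = refl
    ... | no _ = refl
occ≡weight x (app t s) = cong₂ _+_ (occ≡weight x t) (occ≡weight x s)

occ-zero-rename : ∀ {n m} (ρ : Fin n → Fin m) t → occ zero (rename (ext ρ) t) ≡ occ zero t
occ-zero-rename ρ t = begin
  occ zero (rename (ext ρ) t)                 ≡⟨ occ≡weight zero (rename (ext ρ) t) ⟩
  weight (indicator zero) (rename (ext ρ) t)  ≡⟨ weight-rename (indicator zero) (ext ρ) t ⟩
  weight (λ i → indicator zero (ext ρ i)) t   ≡⟨ weight-cong e t ⟩
  weight (indicator zero) t                   ≡⟨ sym (occ≡weight zero t) ⟩
  occ zero t                                  ∎
  where
    e : ∀ i → indicator zero (ext ρ i) ≡ indicator zero i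
    e zero = refl
    e (suc i) = refl

occ-zero-subst : ∀ {n m} (σ : Fin n → Term m) t → occ zero (subst (exts σ) t) ≡ occ zero t
occ-zero-subst σ t = begin
  occ zero (subst (exts σ) t)                           ≡⟨ occ≡weight zero (subst (exts σ) t) ⟩
  weight (indicator zero) (subst (exts σ) t)            ≡⟨ weight-subst (indicator zero) (exts σ) t ⟩
  weight (λ i → weight (indicator zero) (exts σ i)) t   ≡⟨ weight-cong e t ⟩
  weight (indicator zero) t                             ≡⟨ sym (occ≡weight zero t) ⟩
  occ zero t                                            ∎
  where
    e : ∀ i → weight (indicator zero) (exts σ i) ≡ indicator zero i
    e zero = refl
    e (suc i) = trans (weight-rename (indicator zero) suc (σ i)) (weight-zero (σ i))

-- Weight of a β-contractum: the occurrences of 0 in t are replaced by copies of s.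
weight-[0:=] : ∀ {n} (w : Fin n → ℕ) (t : Term (suc n)) (s : Term n) →
               weight w (t [ zero := s ]) ≡ weight (wext w) t + occ zero t * weight w s
weight-[0:=] w t s = begin
  weight w (subst (point zero s) t)
    ≡⟨ weight-subst w (point zero s) t ⟩
  weight (λ i → weight w (point zero s i)) t
    ≡⟨ weight-cong e t ⟩
  weight (λ i → wext w i + indicator zero i * weight w s) t
    ≡⟨ weight-+ (wext w) (λ i → indicator zero i * weight w s) t ⟩
  weight (wext w) t + weight (λ i → indicator zero i * weight w s) t
    ≡⟨ cong (weight (wext w) t +_) (weight-* (indicator zero) (weight w s) t) ⟩
  weight (wext w) t + weight (indicator zero) t * weight w s
    ≡⟨ cong (λ o → weight (wext w) t + o * weight w s) (sym (occ≡weight zero t)) ⟩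
  weight (wext w) t + occ zero t * weight w s ∎
  where
    e : ∀ i → weight w (point zero s i) ≡ wext w i + indicator zero i * weight w s
    e zero = sym (+-identityʳ (weight w s))
    e (suc i) = sym (+-identityʳ (w i))

cast : ∀ {n} {t u u' : Term n} {k k'} → k ≡ k' → u ≡ u' → t ⇒β[ k ] u → t ⇒β[ k' ] u'
cast refl refl d = d

⇒rename : ∀ {n m} (ρ : Fin n → Fin m) {t t' : Term n} {k} →
          t ⇒β[ k ] t' → rename ρ t ⇒β[ k ] rename ρ t'
⇒rename ρ ⇒var = ⇒var
⇒rename ρ (⇒lam d) = ⇒lam (⇒rename (ext ρ) d)
⇒rename ρ (⇒app d e) = ⇒app (⇒rename ρ d) (⇒rename ρ e)
⇒rename ρ (⇒beta {t' = t'} {s' = s'} {n = n} {m = m} d e) =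
  cast (cong (λ o → n + o * m + 1) (occ-zero-rename ρ t')) (rename-[0:=] ρ t' s')
       (⇒beta (⇒rename (ext ρ) d) (⇒rename ρ e))

_⇒σ[_]_ : ∀ {n p} → (Fin n → Term p) → (Fin n → ℕ) → (Fin n → Term p) → Set
σ ⇒σ[ w ] σ' = ∀ i → σ i ⇒β[ w i ] σ' i

⇒exts : ∀ {n p} {σ σ' : Fin n → Term p} {w} → σ ⇒σ[ w ] σ' → exts σ ⇒σ[ wext w ] exts σ'
⇒exts h zero = ⇒var
⇒exts h (suc i) = ⇒rename suc (h i)

beta-index : ∀ n c₁ o m c₂ → (n + c₁) + o * (m + c₂) + 1 ≡ (n + o * m + 1) + (c₁ + o * c₂)
beta-index = solve 5 (λ n c₁ o m c₂ →
  (n :+ c₁) :+ o :* (m :+ c₂) :+ con 1 := (n :+ o :* m :+ con 1) :+ (c₁ :+ o :* c₂)) refl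
  where open +-*-Solver

⇒subst : ∀ {n p} {σ σ' : Fin n → Term p} {w} → σ ⇒σ[ w ] σ' →
         ∀ {t t' : Term n} {k} → t ⇒β[ k ] t' → subst σ t ⇒β[ k + weight w t' ] subst σ' t'
⇒subst h (⇒var {x = i}) = h i
⇒subst h (⇒lam d) = ⇒lam (⇒subst (⇒exts h) d)
⇒subst {w = w} h (⇒app {t' = t'} {s' = s'} {n = n} {m = m} d e) =
  cast (interchange n (weight w t') m (weight w s')) refl
       (⇒app (⇒subst h d) (⇒subst h e))
⇒subst {σ' = σ'} {w} h (⇒beta {t' = t'} {s' = s'} {n = n} {m = m} d e) =
  cast index (subst-[0:=] σ' t' s')
       (⇒beta (⇒subst (⇒exts h) d) (⇒subst h e))
  where
    o = occ zero t'
    c₁ = weight (wext w) t'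
    c₂ = weight w s'
    index : (n + c₁) + occ zero (subst (exts σ') t') * (m + c₂) + 1
            ≡ (n + o * m + 1) + weight w (t' [ zero := s' ])
    index = begin
      (n + c₁) + occ zero (subst (exts σ') t') * (m + c₂) + 1
        ≡⟨ cong (λ o' → (n + c₁) + o' * (m + c₂) + 1) (occ-zero-subst σ' t') ⟩
      (n + c₁) + o * (m + c₂) + 1
        ≡⟨ beta-index n c₁ o m c₂ ⟩
      (n + o * m + 1) + (c₁ + o * c₂)
        ≡⟨ cong ((n + o * m + 1) +_) (sym (weight-[0:=] w t' s')) ⟩
      (n + o * m + 1) + weight w (t' [ zero := s' ]) ∎

point-weight : ∀ {n} → Fin n → ℕ → Fin n → ℕ
point-weight x m y with x ≟ y
... | yes _ = m
... | no _ = 0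

weight-point : ∀ {n} (x : Fin n) m t → weight (point-weight x m) t ≡ occ x t * m
weight-point x m t = begin
  weight (point-weight x m) t          ≡⟨ weight-cong e t ⟩
  weight (λ i → indicator x i * m) t   ≡⟨ weight-* (indicator x) m t ⟩
  weight (indicator x) t * m           ≡⟨ cong (_* m) (sym (occ≡weight x t)) ⟩
  occ x t * m                          ∎
  where
    e : ∀ i → point-weight x m i ≡ indicator x i * m
    e i with x ≟ i
    ... | yes _ = sym (+-identityʳ m)
    ... | no _ = refl

⇒point : ∀ {n} (x : Fin (suc n)) {s s' : Term n} {m} →
         s ⇒β[ m ] s' → point x s ⇒σ[ point-weight x m ] point x s'
⇒point x e i with x ≟ i
... | yes _ = e
... | no _ = ⇒var

lemma2 : ∀ {k} (t t' : Term (suc k)) (s s' : Term k) (x : Fin (suc k)) (n m : ℕ) →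
           t ⇒β[ n ] t' → s ⇒β[ m ] s' →
           (t [ x := s ]) ⇒β[ n + occ x t' * m ] (t' [ x := s' ])
lemma2 t t' s s' x n m d e =
  cast (cong (n +_) (weight-point x m t')) refl (⇒subst (⇒point x e) d)
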